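{- Let $t, r, s$ be non-negative integers. Let $\mathcal{A}$ and $\mathcal{B}$ be non-empty cross-$t$-intersecting families such that every set in $\mathcal{A}$ has exactly $r$ elements, every set in $\mathcal{B}$ has exactly $s$ elements, and $\mathcal{B}$ is not a trivial $t$-intersecting family. Then there exist $B, X \in \mathcal{B}$, a $t$-element subset $T$ of $B$, and an element $x \in X \setminus T$ such that \[|\mathcal{A}| \leq s{s \choose t} |\mathcal{A}(T \cup \{x\})|.\]
   Context: All sets and families (sets of sets) are finite. Families $\mathcal{A}, \mathcal{B}$ are cross-$t$-intersecting if $|A \cap B| \geq t$ for all $A \in \mathcal{A}$, $B \in \mathcal{B}$. A family is $t$-intersecting if any two of its sets (not necessarily distinct) share at least $t$ elements; a $t$-intersecting family is trivial if all its sets have at least $t$ common elements (i.e. the intersection of all its members has size at least $t$). For a family $\mathcal{A}$ and a set $Y$, $\mathcal{A}(Y) = \{A \in \mathcal{A} \colon Y \subseteq A\}$. -}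

module Defs where

open import Data.Nat using (ℕ; _≤_)
open import Data.Fin using (Fin)
open import Data.Fin.Subset using (Subset; _∩_; ⊤; ∣_∣; _⊆_)
open import Data.Fin.Subset.Properties using (_⊆?_)
open import Data.List using (List; filter; foldr; length)
open import Data.List.Membership.Propositional using (_∈_)
open import Data.List.Relation.Unary.Unique.Propositional using (Unique)
open import Data.Product using (_×_)

-- Sets are subsets of a finite ground set Fin n; a family is a duplicate-free
-- list of such subsets (Unique is imposed in the statement), |𝒜| = length 𝒜.
Family : ℕ → Set
Family n = List (Subset n)

CrossIntersecting : ∀ {n} → ℕ → Family n → Family n → Set
CrossIntersecting t 𝒜 ℬ = ∀ {A B} → A ∈ 𝒜 → B ∈ ℬ → t ≤ ∣ A ∩ B ∣

Intersecting : ∀ {n} → ℕ → Family n → Set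
Intersecting t ℬ = CrossIntersecting t ℬ ℬ

⋂ : ∀ {n} → Family n → Subset n
⋂ = foldr _∩_ ⊤

TrivialIntersecting : ∀ {n} → ℕ → Family n → Set
TrivialIntersecting t ℬ = Intersecting t ℬ × (t ≤ ∣ ⋂ ℬ ∣)

sub : ∀ {n} → Family n → Subset n → Family n
sub 𝒜 Y = filter (Y ⊆?_) 𝒜

Uniform : ∀ {n} → ℕ → Family n → Set
Uniform r 𝒜 = ∀ {A} → A ∈ 𝒜 → ∣ A ∣ ≡ r
  where open import Relation.Binary.PropositionalEquality using (_≡_)

module Submission where

-- Fix B ∈ ℬ. Each A ∈ 𝒜 meets B in at least t points, so it contains one of the s choose t
-- t-subsets of B, and by pigeonhole some t-subset T lies in at least |𝒜| / (s choose t) members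
-- of 𝒜. As ℬ is not trivial, T ⊈ X for some X ∈ ℬ; every A ⊇ T has |A ∩ X| ≥ t = |T|, hence
-- A ∩ X ⊈ T, so A contains a point of X ∖ T. A second pigeonhole over the at most s points of
-- X ∖ T yields x.

open import Data.Nat using (ℕ; zero; suc; _≤_; _<_; _*_; _+_; z≤n; s≤s)
open import Data.Nat.Properties
open import Data.Nat.Combinatorics using (_C_; nCk+nC[k+1]≡[n+1]C[k+1])
open import Data.Nat.ListAction using (sum)
open import Data.List using (List; []; _∷_; length; filter; map; _++_)
open import Data.List.Properties using (length-map; length-++)
import Data.List.Extrema.Nat as Extrema
open import Data.List.Membership.Propositional using (_∈_; lose; find)
open import Data.List.Membership.Propositional.Properties
  using (∈-map⁺; ∈-map⁻; ∈-++⁺ˡ; ∈-++⁺ʳ; ∈-++⁻; ∈-filter⁻)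
open import Data.List.Relation.Unary.Any using (Any; here; there)
open import Data.List.Relation.Unary.All using (All; []; _∷_)
import Data.List.Relation.Unary.All as All
open import Data.List.Relation.Unary.All.Properties using (¬All⇒Any¬)
open import Data.List.Relation.Unary.Unique.Propositional using (Unique)
open import Data.List.Relation.Binary.Sublist.Propositional.Properties
  using (filter-⊆; filter⁺; length-mono-≤)
open import Data.Vec using ([]; _∷_)
open import Data.Vec.Base using () renaming (here to here-v; there to there-v)
open import Data.Fin using (Fin; zero; suc)
open import Data.Fin.Subset
  using (Subset; inside; outside; _∪_; _∩_; ⁅_⁆; ∁; ⊥; ∣_∣; _⊆_; _⊈_; _∉_)
  renaming (_∈_ to _∈ˢ_)
open import Data.Fin.Subset.Properties
open import Data.Product using (_×_; _,_; ∃-syntax)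
import Data.Product as Product
open import Data.Sum using (inj₁; inj₂; [_,_]′)
open import Function using (_∘_)
open import Relation.Binary.PropositionalEquality using (_≡_; _≢_; refl; sym; trans; cong; cong₂; subst; subst₂; module ≡-Reasoning)
open import Relation.Nullary using (¬_; yes; no; contradiction)
open import Relation.Unary using (Decidable)

open import Defs

sum-map≤length* : ∀ {A : Set} (f : A → ℕ) {k} xs → All (λ x → f x ≤ k) xs →
                  sum (map f xs) ≤ length xs * k
sum-map≤length* f []       []           = z≤n
sum-map≤length* f (x ∷ xs) (fx≤k ∷ fxs≤k) = +-mono-≤ fx≤k (sum-map≤length* f xs fxs≤k)

∃-sum-map≤length* : ∀ {A : Set} (f : A → ℕ) (x : A) xs →
                    ∃[ m ] (m ∈ x ∷ xs × sum (map f (x ∷ xs)) ≤ length (x ∷ xs) * f m)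
∃-sum-map≤length* {A} f x xs =
  m , m∈x∷xs ,
  sum-map≤length* f (x ∷ xs) (f[⊥]≤f[argmax] {f = f} x xs ∷ f[xs]≤f[argmax] x xs)
  where
  open Extrema
  m : A
  m = argmax f x xs
  m∈x∷xs : m ∈ x ∷ xs
  m∈x∷xs = [ here , there ]′ (argmax-sel f x xs)

module Pigeonhole {C D : Set} {P : C → D → Set} (P? : ∀ c → Decidable (P c)) where

  count : C → List D → ℕ
  count c ds = length (filter (P? c) ds)

  count-∷-≤ : ∀ c d ds → count c ds ≤ count c (d ∷ ds)
  count-∷-≤ c d ds with P? c d
  ... | yes _ = n≤1+n _
  ... | no _  = ≤-refl

  count-∷-< : ∀ {c d} ds → P c d → count c ds < count c (d ∷ ds)
  count-∷-< {c} {d} ds p with P? c d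
  ... | yes _ = ≤-refl
  ... | no ¬p = contradiction p ¬p

  totalCount : List C → List D → ℕ
  totalCount cs ds = sum (map (λ c → count c ds) cs)

  totalCount-∷-≤ : ∀ cs d ds → totalCount cs ds ≤ totalCount cs (d ∷ ds)
  totalCount-∷-≤ []       d ds = z≤n
  totalCount-∷-≤ (c ∷ cs) d ds = +-mono-≤ (count-∷-≤ c d ds) (totalCount-∷-≤ cs d ds)

  totalCount-∷-< : ∀ {cs d} ds → Any (λ c → P c d) cs → totalCount cs ds < totalCount cs (d ∷ ds)
  totalCount-∷-< {c ∷ cs} {d} ds (here p)  = +-mono-<-≤ (count-∷-< ds p) (totalCount-∷-≤ cs d ds)
  totalCount-∷-< {c ∷ cs} {d} ds (there a) = +-mono-≤-< (count-∷-≤ c d ds) (totalCount-∷-< ds a)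

  length≤totalCount : ∀ cs ds → (∀ {d} → d ∈ ds → Any (λ c → P c d) cs) → length ds ≤ totalCount cs ds
  length≤totalCount cs []       covered = z≤n
  length≤totalCount cs (d ∷ ds) covered =
    ≤-trans (s≤s (length≤totalCount cs ds (covered ∘ there))) (totalCount-∷-< ds (covered (here refl)))

  pigeonhole : ∀ cs ds → ds ≢ [] → (∀ {d} → d ∈ ds → Any (λ c → P c d) cs) →
               ∃[ c ] (c ∈ cs × length ds ≤ length cs * count c ds)
  pigeonhole cs       []       ds≢[] covered = contradiction refl ds≢[]
  pigeonhole []       (d ∷ ds) ds≢[] covered with covered (here refl)
  ... | ()
  pigeonhole (c ∷ cs) ds       ds≢[] covered =
    let m , m∈cs , sum≤ = ∃-sum-map≤length* (λ e → count e ds) c cs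
    in  m , m∈cs , ≤-trans (length≤totalCount (c ∷ cs) ds covered) sum≤

subsetsOfSize : ∀ {n} → Subset n → ℕ → List (Subset n)
subsetsOfSize []            zero    = [] ∷ []
subsetsOfSize []            (suc k) = []
subsetsOfSize (outside ∷ p) k       = map (outside ∷_) (subsetsOfSize p k)
subsetsOfSize (inside  ∷ p) zero    = map (outside ∷_) (subsetsOfSize p zero)
subsetsOfSize (inside  ∷ p) (suc k) =
  map (inside ∷_) (subsetsOfSize p k) ++ map (outside ∷_) (subsetsOfSize p (suc k))

nC0≡1 : ∀ n → n C 0 ≡ 1
nC0≡1 zero    = refl
nC0≡1 (suc n) = refl

length-subsetsOfSize : ∀ {n} (p : Subset n) k → length (subsetsOfSize p k) ≡ ∣ p ∣ C k
length-subsetsOfSize []            zero    = refl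
length-subsetsOfSize []            (suc k) = refl
length-subsetsOfSize (outside ∷ p) k       =
  trans (length-map _ (subsetsOfSize p k)) (length-subsetsOfSize p k)
length-subsetsOfSize (inside  ∷ p) zero    =
  trans (length-map _ (subsetsOfSize p zero)) (trans (length-subsetsOfSize p zero) (nC0≡1 ∣ p ∣))
length-subsetsOfSize (inside  ∷ p) (suc k) = begin
  length (map (inside ∷_) (subsetsOfSize p k) ++ map (outside ∷_) (subsetsOfSize p (suc k)))
    ≡⟨ length-++ (map (inside ∷_) (subsetsOfSize p k)) ⟩
  length (map (inside ∷_) (subsetsOfSize p k)) + length (map (outside ∷_) (subsetsOfSize p (suc k)))
    ≡⟨ cong₂ _+_ (length-map _ (subsetsOfSize p k)) (length-map _ (subsetsOfSize p (suc k))) ⟩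
  length (subsetsOfSize p k) + length (subsetsOfSize p (suc k))
    ≡⟨ cong₂ _+_ (length-subsetsOfSize p k) (length-subsetsOfSize p (suc k)) ⟩
  ∣ p ∣ C k + ∣ p ∣ C suc k
    ≡⟨ nCk+nC[k+1]≡[n+1]C[k+1] ∣ p ∣ k ⟩
  suc ∣ p ∣ C suc k ∎
  where open ≡-Reasoning

∈-subsetsOfSize⁻ : ∀ {n} (p : Subset n) k {q} → q ∈ subsetsOfSize p k → q ⊆ p × ∣ q ∣ ≡ k
∈-subsetsOfSize⁻ []            zero    (here refl) = ⊆-refl , refl
∈-subsetsOfSize⁻ (outside ∷ p) k       q∈ with ∈-map⁻ _ q∈
... | q , q∈′ , refl = Product.map₁ out⊆ (∈-subsetsOfSize⁻ p k q∈′)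
∈-subsetsOfSize⁻ (inside  ∷ p) zero    q∈ with ∈-map⁻ _ q∈
... | q , q∈′ , refl = Product.map₁ out⊆ (∈-subsetsOfSize⁻ p zero q∈′)
∈-subsetsOfSize⁻ (inside  ∷ p) (suc k) q∈ with ∈-++⁻ (map (inside ∷_) (subsetsOfSize p k)) q∈
... | inj₁ q∈ˡ with ∈-map⁻ _ q∈ˡ
...   | q , q∈′ , refl = Product.map in⊆in (cong suc) (∈-subsetsOfSize⁻ p k q∈′)
∈-subsetsOfSize⁻ (inside  ∷ p) (suc k) q∈ | inj₂ q∈ʳ with ∈-map⁻ _ q∈ʳ
...   | q , q∈′ , refl = Product.map₁ out⊆ (∈-subsetsOfSize⁻ p (suc k) q∈′)

∈-subsetsOfSize⁺ : ∀ {n} {p q : Subset n} → q ⊆ p → q ∈ subsetsOfSize p ∣ q ∣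
∈-subsetsOfSize⁺ {p = []}          {[]}          q⊆p = here refl
∈-subsetsOfSize⁺ {p = outside ∷ p} {outside ∷ q} q⊆p = ∈-map⁺ _ (∈-subsetsOfSize⁺ (drop-∷-⊆ q⊆p))
∈-subsetsOfSize⁺ {p = outside ∷ p} {inside  ∷ q} q⊆p with q⊆p here-v
... | ()
∈-subsetsOfSize⁺ {p = inside  ∷ p} {outside ∷ q} q⊆p
  with ∣ q ∣ | ∈-subsetsOfSize⁺ (drop-∷-⊆ q⊆p)
... | zero  | q∈ = ∈-map⁺ _ q∈
... | suc k | q∈ = ∈-++⁺ʳ (map (inside ∷_) (subsetsOfSize p k)) (∈-map⁺ _ q∈)
∈-subsetsOfSize⁺ {p = inside  ∷ p} {inside  ∷ q} q⊆p = ∈-++⁺ˡ (∈-map⁺ _ (∈-subsetsOfSize⁺ (drop-∷-⊆ q⊆p)))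

∃⊆-ofSize : ∀ {n} (p : Subset n) {k} → k ≤ ∣ p ∣ → ∃[ q ] (q ⊆ p × ∣ q ∣ ≡ k)
∃⊆-ofSize {n} p {zero} _ = ⊥ , ⊆-min p , ∣⊥∣≡0 n
∃⊆-ofSize (outside ∷ p) {suc k} k<∣p∣ =
  let q , q⊆p , ∣q∣≡k = ∃⊆-ofSize p k<∣p∣ in outside ∷ q , s⊆s q⊆p , ∣q∣≡k
∃⊆-ofSize (inside  ∷ p) {suc k} (s≤s k≤∣p∣) =
  let q , q⊆p , ∣q∣≡k = ∃⊆-ofSize p k≤∣p∣ in inside ∷ q , s⊆s q⊆p , cong suc ∣q∣≡k

contains-subsetOfSize : ∀ {n} {k} (A B : Subset n) → k ≤ ∣ A ∩ B ∣ → Any (_⊆ A) (subsetsOfSize B k)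
contains-subsetOfSize A B k≤∣A∩B∣ =
  let q , q⊆A∩B , ∣q∣≡k = ∃⊆-ofSize (A ∩ B) k≤∣A∩B∣
  in  lose (subst (_∈_ q ∘ subsetsOfSize B) ∣q∣≡k (∈-subsetsOfSize⁺ (⊆-trans q⊆A∩B (p∩q⊆q A B))))
           (⊆-trans q⊆A∩B (p∩q⊆p A B))

elements : ∀ {n} → Subset n → List (Fin n)
elements []            = []
elements (inside  ∷ p) = zero ∷ map suc (elements p)
elements (outside ∷ p) = map suc (elements p)

length-elements : ∀ {n} (p : Subset n) → length (elements p) ≡ ∣ p ∣
length-elements []            = refl
length-elements (inside  ∷ p) = cong suc (trans (length-map suc (elements p)) (length-elements p))
length-elements (outside ∷ p) = trans (length-map suc (elements p)) (length-elements p)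

∈-elements⁺ : ∀ {n} {p : Subset n} {x} → x ∈ˢ p → x ∈ elements p
∈-elements⁺ {p = inside  ∷ p} here-v       = here refl
∈-elements⁺ {p = inside  ∷ p} (there-v x∈p) = there (∈-map⁺ suc (∈-elements⁺ x∈p))
∈-elements⁺ {p = outside ∷ p} (there-v x∈p) = ∈-map⁺ suc (∈-elements⁺ x∈p)

∈-elements⁻ : ∀ {n} (p : Subset n) {x} → x ∈ elements p → x ∈ˢ p
∈-elements⁻ (inside  ∷ p) (here refl) = here-v
∈-elements⁻ (inside  ∷ p) (there x∈)  with ∈-map⁻ suc x∈
... | y , y∈ , refl = there-v (∈-elements⁻ p y∈)
∈-elements⁻ (outside ∷ p) x∈          with ∈-map⁻ suc x∈
... | y , y∈ , refl = there-v (∈-elements⁻ p y∈)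

p⊆q∧∣q∣≤∣p∣⇒q⊆p : ∀ {n} {p q : Subset n} → p ⊆ q → ∣ q ∣ ≤ ∣ p ∣ → q ⊆ p
p⊆q∧∣q∣≤∣p∣⇒q⊆p {p = []}          {[]}          _   _   = ⊆-refl
p⊆q∧∣q∣≤∣p∣⇒q⊆p {p = outside ∷ p} {outside ∷ q} p⊆q ∣q∣≤∣p∣ =
  out⊆ (p⊆q∧∣q∣≤∣p∣⇒q⊆p (drop-∷-⊆ p⊆q) ∣q∣≤∣p∣)
p⊆q∧∣q∣≤∣p∣⇒q⊆p {p = outside ∷ p} {inside  ∷ q} p⊆q ∣q∣<∣p∣ =
  contradiction (p⊆q⇒∣p∣≤∣q∣ (drop-∷-⊆ p⊆q)) (<⇒≱ ∣q∣<∣p∣)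
p⊆q∧∣q∣≤∣p∣⇒q⊆p {p = inside  ∷ p} {outside ∷ q} p⊆q _ with p⊆q here-v
... | ()
p⊆q∧∣q∣≤∣p∣⇒q⊆p {p = inside  ∷ p} {inside  ∷ q} p⊆q (s≤s ∣q∣≤∣p∣) =
  in⊆in (p⊆q∧∣q∣≤∣p∣⇒q⊆p (drop-∷-⊆ p⊆q) ∣q∣≤∣p∣)

∣q∣≤∣p∣∧p⊆r∧q⊈r⇒p⊈q : ∀ {n} {p q r : Subset n} → ∣ q ∣ ≤ ∣ p ∣ → p ⊆ r → q ⊈ r → p ⊈ q
∣q∣≤∣p∣∧p⊆r∧q⊈r⇒p⊈q ∣q∣≤∣p∣ p⊆r q⊈r p⊆q = q⊈r (⊆-trans (p⊆q∧∣q∣≤∣p∣⇒q⊆p p⊆q ∣q∣≤∣p∣) p⊆r)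

p⊈q⇒∃∈∉ : ∀ {n} {p q : Subset n} → p ⊈ q → ∃[ x ] (x ∈ˢ p × x ∉ q)
p⊈q⇒∃∈∉ {p = []}          {[]}          p⊈q = contradiction (λ ()) p⊈q
p⊈q⇒∃∈∉ {p = inside  ∷ p} {outside ∷ q} p⊈q = zero , here-v , λ ()
p⊈q⇒∃∈∉ {p = inside  ∷ p} {inside  ∷ q} p⊈q =
  let x , x∈p , x∉q = p⊈q⇒∃∈∉ (p⊈q ∘ in⊆in) in suc x , there-v x∈p , x∉q ∘ drop-there
p⊈q⇒∃∈∉ {p = outside ∷ p} {_       ∷ q} p⊈q =
  let x , x∈p , x∉q = p⊈q⇒∃∈∉ (p⊈q ∘ out⊆) in suc x , there-v x∈p , x∉q ∘ drop-there

q⊆p∧x∈p⇒q∪⁅x⁆⊆p : ∀ {n} {p q : Subset n} {x} → q ⊆ p → x ∈ˢ p → q ∪ ⁅ x ⁆ ⊆ p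
q⊆p∧x∈p⇒q∪⁅x⁆⊆p {q = q} {x} q⊆p x∈p y∈q∪⁅x⁆ =
  [ q⊆p , (λ y∈⁅x⁆ → subst (_∈ˢ _) (sym (x∈⁅y⁆⇒x≡y x y∈⁅x⁆)) x∈p) ]′ (x∈p∪q⁻ q ⁅ x ⁆ y∈q∪⁅x⁆)

⊆-⋂ : ∀ {n} {q : Subset n} {ℬ : Family n} → All (q ⊆_) ℬ → q ⊆ ⋂ ℬ
⊆-⋂ {q = q} []        = ⊆-max q
⊆-⋂ (q⊆X ∷ q⊆ℬ) x∈q = x∈p∩q⁺ (q⊆X x∈q , ⊆-⋂ q⊆ℬ x∈q)

common-subset⇒trivial : ∀ {n} {t} {q : Subset n} {ℬ : Family n} →
                        All (q ⊆_) ℬ → t ≤ ∣ q ∣ → TrivialIntersecting t ℬ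
common-subset⇒trivial q⊆ℬ t≤∣q∣ =
  (λ X∈ℬ Y∈ℬ → ≤-trans t≤∣q∣ (p⊆q⇒∣p∣≤∣q∣ λ x∈q →
     x∈p∩q⁺ (All.lookup q⊆ℬ X∈ℬ x∈q , All.lookup q⊆ℬ Y∈ℬ x∈q))) ,
  ≤-trans t≤∣q∣ (p⊆q⇒∣p∣≤∣q∣ (⊆-⋂ q⊆ℬ))

length-sub-sub≤ : ∀ {n} (𝒜 : Family n) Y Z → length (sub (sub 𝒜 Y) Z) ≤ length (sub 𝒜 Z)
length-sub-sub≤ 𝒜 Y Z =
  length-mono-≤ (filter⁺ (Z ⊆?_) (Z ⊆?_) (λ { refl Z⊆A → Z⊆A }) (filter-⊆ (Y ⊆?_) 𝒜))

≤*length⇒≢[] : ∀ {A B : Set} {xs : List A} {ys : List B} k →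
               length xs ≤ k * length ys → xs ≢ [] → ys ≢ []
≤*length⇒≢[] {xs = []}    k _      xs≢[] _    = xs≢[] refl
≤*length⇒≢[] {xs = x ∷ xs} k len≤ _     refl with subst (length (x ∷ xs) ≤_) (*-zeroʳ k) len≤
... | ()

≤*-trans : ∀ {a b c} k l → a ≤ k * b → b ≤ l * c → a ≤ l * k * c
≤*-trans {a} {b} {c} k l a≤k*b b≤l*c = begin
  a           ≤⟨ a≤k*b ⟩
  k * b       ≤⟨ *-monoʳ-≤ k b≤l*c ⟩
  k * (l * c) ≡⟨ *-assoc k l c ⟨
  k * l * c   ≡⟨ cong (_* c) (*-comm k l) ⟩
  l * k * c   ∎
  where open ≤-Reasoning

∃-popular-subsetOfSize :
  ∀ {n} t (𝒜 : Family n) B → 𝒜 ≢ [] → (∀ {A} → A ∈ 𝒜 → t ≤ ∣ A ∩ B ∣) →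
  ∃[ T ] (T ⊆ B × ∣ T ∣ ≡ t × length 𝒜 ≤ (∣ B ∣ C t) * length (sub 𝒜 T))
∃-popular-subsetOfSize t 𝒜 B 𝒜≢[] t≤∣A∩B∣ =
  let T , T∈ , bound = pigeonhole (subsetsOfSize B t) 𝒜 𝒜≢[]
                         (λ {A} A∈𝒜 → contains-subsetOfSize A B (t≤∣A∩B∣ A∈𝒜))
      T⊆B , ∣T∣≡t    = ∈-subsetsOfSize⁻ B t T∈
  in  T , T⊆B , ∣T∣≡t , subst (λ m → length 𝒜 ≤ m * length (sub 𝒜 T)) (length-subsetsOfSize B t) bound
  where open Pigeonhole _⊆?_

∃-popular-extension :
  ∀ {n} (𝒜 : Family n) T X → 𝒜 ≢ [] → T ⊈ X →
  (∀ {A} → A ∈ 𝒜 → T ⊆ A × ∣ T ∣ ≤ ∣ A ∩ X ∣) →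
  ∃[ x ] (x ∈ˢ X × x ∉ T × length 𝒜 ≤ ∣ X ∣ * length (sub 𝒜 (T ∪ ⁅ x ⁆)))
∃-popular-extension 𝒜 T X 𝒜≢[] T⊈X 𝒜⊆ =
  let x , x∈ , bound = pigeonhole (elements (X ∩ ∁ T)) 𝒜 𝒜≢[] covered
      x∈X , x∈∁T     = x∈p∩q⁻ X (∁ T) (∈-elements⁻ (X ∩ ∁ T) x∈)
  in  x , x∈X , x∈∁p⇒x∉p x∈∁T ,
      ≤-trans bound (*-monoˡ-≤ _ (≤-trans (≤-reflexive (length-elements (X ∩ ∁ T))) (∣p∩q∣≤∣p∣ X (∁ T))))
  where
  open Pigeonhole (λ x → (T ∪ ⁅ x ⁆) ⊆?_)
  covered : ∀ {A} → A ∈ 𝒜 → Any (λ x → T ∪ ⁅ x ⁆ ⊆ A) (elements (X ∩ ∁ T))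
  covered A∈𝒜 =
    let T⊆A , ∣T∣≤∣A∩X∣ = 𝒜⊆ A∈𝒜
        x , x∈A∩X , x∉T = p⊈q⇒∃∈∉ (∣q∣≤∣p∣∧p⊆r∧q⊈r⇒p⊈q ∣T∣≤∣A∩X∣ (p∩q⊆q _ X) T⊈X)
        x∈A , x∈X       = x∈p∩q⁻ _ X x∈A∩X
    in  lose (∈-elements⁺ (x∈p∩q⁺ (x∈X , x∉p⇒x∈∁p x∉T))) (q⊆p∧x∈p⇒q∪⁅x⁆⊆p T⊆A x∈A)

lemma3p3 : (n t r s : ℕ) (𝒜 ℬ : Family n) →
    Unique 𝒜 → Unique ℬ →
    𝒜 ≢ [] → ℬ ≢ [] →
    CrossIntersecting t 𝒜 ℬ →
    Uniform r 𝒜 → Uniform s ℬ →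
    ¬ TrivialIntersecting t ℬ →
    ∃[ B ] ∃[ X ] ∃[ T ] ∃[ x ]
      (B ∈ ℬ × X ∈ ℬ × T ⊆ B × ∣ T ∣ ≡ t × x ∈ˢ X × x ∉ T ×
       length 𝒜 ≤ s * (s C t) * length (sub 𝒜 (T ∪ ⁅ x ⁆)))
lemma3p3 n t r s 𝒜 []        _ _ _    ℬ≢[] _     _ _         _        = contradiction refl ℬ≢[]
lemma3p3 n t r s 𝒜 ℬ@(B ∷ _) _ _ 𝒜≢[] _    cross _ uniform-ℬ ¬trivial =
  let B∈ℬ                   = here refl
      T , T⊆B , ∣T∣≡t , 𝒜≤  = ∃-popular-subsetOfSize t 𝒜 B 𝒜≢[] (λ A∈𝒜 → cross A∈𝒜 B∈ℬ)
      X , X∈ℬ , T⊈X         = find (¬All⇒Any¬ (T ⊆?_) ℬ λ T⊆ℬ →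
                                 ¬trivial (common-subset⇒trivial T⊆ℬ (≤-reflexive (sym ∣T∣≡t))))
      x , x∈X , x∉T , 𝒜[T]≤ = ∃-popular-extension (sub 𝒜 T) T X
                                 (≤*length⇒≢[] (∣ B ∣ C t) 𝒜≤ 𝒜≢[]) T⊈X λ {A} A∈𝒜[T] →
                                   let A∈𝒜 , T⊆A = ∈-filter⁻ (T ⊆?_) A∈𝒜[T]
                                   in  T⊆A , subst (_≤ ∣ A ∩ X ∣) (sym ∣T∣≡t) (cross A∈𝒜 X∈ℬ)
      𝒜[T∪x] = sub 𝒜 (T ∪ ⁅ x ⁆)
      bound = ≤*-trans (∣ B ∣ C t) ∣ X ∣ 𝒜≤
                (≤-trans 𝒜[T]≤ (*-monoʳ-≤ ∣ X ∣ (length-sub-sub≤ 𝒜 T (T ∪ ⁅ x ⁆))))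
  in  B , X , T , x , B∈ℬ , X∈ℬ , T⊆B , ∣T∣≡t , x∈X , x∉T ,
      subst₂ (λ b y → length 𝒜 ≤ y * (b C t) * length 𝒜[T∪x]) (uniform-ℬ B∈ℬ) (uniform-ℬ X∈ℬ) bound
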